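{- Let $A,B,C$ be justified AJM games and let $O_{\mathsf{sk}}$ be an operation assigning to each skeleton $\phi$ on $A$ and skeleton $\psi$ on $B$ a skeleton $O_{\mathsf{sk}}(\phi,\psi)$ on $C$. For strategies $\sigma$ on $A$ and $\tau$ on $B$, set $O(\sigma,\tau)=O_{\mathsf{sk}}(\phi,\psi)^\bullet$ where $\phi$ is a skeleton of $\sigma$ and $\psi$ a skeleton of $\tau$. Then $O$ is well-defined (independent of the choice of skeletons) and monotone with respect to subset inclusion if and only if $O_{\mathsf{sk}}$ is monotone with respect to $\sqsubseteq_{\approx}$ (i.e. $\phi\sqsubseteq_{\approx}\phi'$ and $\psi\sqsubseteq_{\approx}\psi'$ imply $O_{\mathsf{sk}}(\phi,\psi)\sqsubseteq_{\approx}O_{\mathsf{sk}}(\phi',\psi')$).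
   Context: A justified AJM game $A=(M_A,\lambda_A,\mathsf{j}_A,P_A,\approx_A)$: set of moves; labelling $\lambda_A:M_A\to\{P,O\}\times\{Q,A\}$; a partial justification function (well-founded; P-moves justified by O-moves and vice versa; answers justified by questions); a non-empty prefix-closed set $P_A$ of finite move sequences (plays) which start with an O-move, alternate O/P, contain each move at most once, are prefixes of well-bracketed strings, and contain the justifier of each move earlier; an equivalence $\approx_A$ on $P_A$ such that (e1) $s\approx_A t$ implies equal label sequences, (e2) equal-length prefixes of equivalent plays are equivalent, (e3) $s\approx_A t$, $sa\in P_A$ imply $sa\approx_A tb$ for some $b$. A strategy on $A$: a non-empty set $\sigma$ of even-length plays with Causal Consistency ($sab\in\sigma\Rightarrow s\in\sigma$), Representation Independence ($s\in\sigma$, $s\approx_A t\Rightarrow t\in\sigma$), Determinacy ($sab,ta'b'\in\sigma$, $sa\approx_A ta'\Rightarrow sab\approx_A ta'b'$). A skeleton of $\sigma$: a non-empty causally consistent subset $\phi\subseteq\sigma$ with Uniformization (for all $sab\in\sigma$ with $s\in\phi$ there is a unique $b'$ with $sab'\in\phi$); every strategy has one. A skeleton in the general sense: a non-empty causally consistent set of even-length plays satisfying Functional Determinacy ($sab,sac\in\phi\Rightarrow b=c$) and Functional Representation Independence (if $sab\in\phi$, $t\in\phi$, $sa\approx_A ta'$ then there is a unique $b'$ with $ta'b'\in\phi$ and $sab\approx_A ta'b'$). $\phi^\bullet=\{t\mid\exists s\in\phi.\ s\approx t\}$ (a strategy whenever $\phi$ is a skeleton). Preorder: $\phi\sqsubseteq_{\approx}\psi$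 iff whenever $sab\in\phi$, $s'\in\psi$ and $sa\approx s'a'$, there exists $b'$ with $s'a'b'\in\psi$ and $sab\approx s'a'b'$. -}

module Defs where

open import Level using (0ℓ)
open import Data.Nat using (ℕ)
open import Data.Nat.Divisibility using (_∣_)
open import Data.List using (List; []; _∷_; _++_; _∷ʳ_; map; length)
open import Data.List.Membership.Propositional using (_∈_)
open import Data.List.Relation.Unary.Unique.Propositional using (Unique)
open import Data.Unit using (⊤)
open import Data.Maybe using (Maybe; just; nothing)
open import Data.Product using (Σ; ∃; ∃!; _×_; _,_; proj₁)
open import Relation.Binary.PropositionalEquality using (_≡_)
open import Relation.Unary using (Pred; _⊆_; _≐_)
open import Induction.WellFounded using (WellFounded)

data Pol : Set where
  O P : Pol

data QA : Set where
  Q Ans : QA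

opp : Pol → Pol
opp O = P
opp P = O

data WB : List QA → Set where
  wb-nil  : WB []
  wb-wrap : ∀ {w} → WB w → WB (Q ∷ (w ∷ʳ Ans))
  wb-cat  : ∀ {w v} → WB w → WB v → WB (w ++ v)

PrefixWB : List QA → Set
PrefixWB w = ∃ λ u → WB (w ++ u)

Justifies : {M : Set} → (M → Maybe M) → M → M → Set
Justifies j n m = j m ≡ just n

Alt : {M : Set} → (M → Pol) → Pol → List M → Set
Alt pol p []      = ⊤
Alt pol p (m ∷ s) = pol m ≡ p × Alt pol (opp p) s

record Game : Set₁ where
  field
    M   : Set
    pol : M → Pol
    qa  : M → QA
    j   : M → Maybe M
    j-wf  : WellFounded (Justifies j)
    j-pol : ∀ {m n} → Justifies j n m → pol n ≡ opp (pol m)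
    j-ans : ∀ m → qa m ≡ Ans → ∃ λ n → Justifies j n m × qa n ≡ Q

  field
    Plays : Pred (List M) 0ℓ
    plays-nonempty  : ∃ Plays
    plays-prefix    : ∀ s t → Plays (s ++ t) → Plays s
    plays-alt       : ∀ {s} → Plays s → Alt pol O s
    plays-unique    : ∀ {s} → Plays s → Unique s
    plays-wb        : ∀ {s} → Plays s → PrefixWB (map qa s)
    plays-justified : ∀ {s m n} → Plays (s ∷ʳ m) → Justifies j n m → n ∈ s
    _≈_       : List M → List M → Set
    ≈-plays   : ∀ {s t} → s ≈ t → Plays s × Plays t
    ≈-refl    : ∀ {s} → Plays s → s ≈ s
    ≈-sym     : ∀ {s t} → s ≈ t → t ≈ s
    ≈-trans   : ∀ {s t u} → s ≈ t → t ≈ u → s ≈ u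
    ≈-labels  : ∀ {s t} → s ≈ t → map pol s ≡ map pol t × map qa s ≡ map qa t
    ≈-prefix  : ∀ {s t s' t' u v} → s ≈ t → s ≡ s' ++ u → t ≡ t' ++ v →
                length s' ≡ length t' → s' ≈ t'
    ≈-extend  : ∀ {s t a} → s ≈ t → Plays (s ∷ʳ a) → ∃ λ b → (s ∷ʳ a) ≈ (t ∷ʳ b)

module _ (G : Game) where
  open Game G

  PSet : Set₁
  PSet = Pred (List M) 0ℓ

  EvenPlays : PSet → Set
  EvenPlays σ = ∀ {s} → σ s → Plays s × (2 ∣ length s)

  CausallyConsistent : PSet → Set
  CausallyConsistent σ = ∀ {s a b} → σ (s ∷ʳ a ∷ʳ b) → σ s

  record IsStrategy (σ : PSet) : Set where
    field
      even     : EvenPlays σ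
      nonempty : ∃ σ
      causal   : CausallyConsistent σ
      repInd   : ∀ {s t} → σ s → s ≈ t → σ t
      determ   : ∀ {s a b t a' b'} → σ (s ∷ʳ a ∷ʳ b) → σ (t ∷ʳ a' ∷ʳ b') →
                 (s ∷ʳ a) ≈ (t ∷ʳ a') → (s ∷ʳ a ∷ʳ b) ≈ (t ∷ʳ a' ∷ʳ b')

  record IsSkeletonOf (σ : PSet) (φ : PSet) : Set where
    field
      sub      : φ ⊆ σ
      nonempty : ∃ φ
      causal   : CausallyConsistent φ
      uniform  : ∀ {s a b} → σ (s ∷ʳ a ∷ʳ b) → φ s →
                 ∃! _≡_ (λ b' → φ (s ∷ʳ a ∷ʳ b'))

  record IsSkeleton (φ : PSet) : Set where
    field
      even     : EvenPlays φ
      nonempty : ∃ φ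
      causal   : CausallyConsistent φ
      funDet   : ∀ {s a b c} → φ (s ∷ʳ a ∷ʳ b) → φ (s ∷ʳ a ∷ʳ c) → b ≡ c
      funRepInd : ∀ {s a b t a'} → φ (s ∷ʳ a ∷ʳ b) → φ t → (s ∷ʳ a) ≈ (t ∷ʳ a') →
                  ∃! _≡_ (λ b' → φ (t ∷ʳ a' ∷ʳ b') × (s ∷ʳ a ∷ʳ b) ≈ (t ∷ʳ a' ∷ʳ b'))

  Skeleton : Set₁
  Skeleton = Σ PSet IsSkeleton

  bullet : PSet → PSet
  bullet φ t = ∃ λ s → φ s × s ≈ t

  _⊑≈_ : PSet → PSet → Set
  φ ⊑≈ ψ = ∀ {s a b s' a'} → φ (s ∷ʳ a ∷ʳ b) → ψ s' → (s ∷ʳ a) ≈ (s' ∷ʳ a') →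
           ∃ λ b' → ψ (s' ∷ʳ a' ∷ʳ b') × (s ∷ʳ a ∷ʳ b) ≈ (s' ∷ʳ a' ∷ʳ b')

module _ (A B C : Game) (Osk : Skeleton A → Skeleton B → Skeleton C) where

  OWellDefined : Set₁
  OWellDefined =
    ∀ (σ : PSet A) (τ : PSet B) → IsStrategy A σ → IsStrategy B τ →
    (φ φ' : Skeleton A) (ψ ψ' : Skeleton B) →
    IsSkeletonOf A σ (proj₁ φ) → IsSkeletonOf A σ (proj₁ φ') →
    IsSkeletonOf B τ (proj₁ ψ) → IsSkeletonOf B τ (proj₁ ψ') →
    bullet C (proj₁ (Osk φ ψ)) ≐ bullet C (proj₁ (Osk φ' ψ'))

  OMonotone : Set₁
  OMonotone =
    ∀ (σ σ' : PSet A) (τ τ' : PSet B) →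
    IsStrategy A σ → IsStrategy A σ' → IsStrategy B τ → IsStrategy B τ' →
    σ ⊆ σ' → τ ⊆ τ' →
    (φ φ' : Skeleton A) (ψ ψ' : Skeleton B) →
    IsSkeletonOf A σ (proj₁ φ) → IsSkeletonOf A σ' (proj₁ φ') →
    IsSkeletonOf B τ (proj₁ ψ) → IsSkeletonOf B τ' (proj₁ ψ') →
    bullet C (proj₁ (Osk φ ψ)) ⊆ bullet C (proj₁ (Osk φ' ψ'))

  OskMonotone : Set₁
  OskMonotone =
    ∀ (φ φ' : Skeleton A) (ψ ψ' : Skeleton B) →
    _⊑≈_ A (proj₁ φ) (proj₁ φ') → _⊑≈_ B (proj₁ ψ) (proj₁ ψ') →
    _⊑≈_ C (proj₁ (Osk φ ψ)) (proj₁ (Osk φ' ψ'))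

module Submission where

-- For a game G, call χ ↦ χ^• (Defs.bullet) the saturation of a set of plays
-- under ≈.  The whole proof rests on four facts about a single game:
--   (1) χ ⊑≈ χ' implies χ^• ⊆ χ'^• (for even-length causally consistent χ, χ');
--       proved by matching every play of χ, pair of moves by pair of moves,
--       with an equivalent play of χ'.
--   (2) if σ ⊆ σ' are strategies (only σ' is used) with skeletons φ, φ',
--       then φ ⊑≈ φ'; determinacy of σ' makes the extension found in φ' equivalent.
--   (3) conversely χ^• ⊆ χ'^• implies χ ⊑≈ χ' when χ' is a skeleton.
--   (4) a skeleton φ generates a strategy φ^• of which φ is a skeleton.
-- Monotonicity of Osk then gives monotonicity of O by (2) then (1), and
-- well-definedness is the special case σ = σ', τ = τ' applied both ways.
-- Conversely, given φ ⊑≈ φ' and ψ ⊑≈ ψ', (1) and (4) produce strategies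
-- φ^• ⊆ φ'^• and ψ^• ⊆ ψ'^• with the given skeletons; monotonicity of O and
-- (3) then yield Osk(φ,ψ) ⊑≈ Osk(φ',ψ').

open import Defs
open import Data.Product using (_×_)
open import Function.Bundles using (_⇔_)

open import Data.Product using (Σ; ∃; _,_; proj₁; proj₂)
open import Data.Nat using (ℕ; zero; suc; _*_)
open import Data.Nat.Properties using (suc-injective; +-comm)
open import Data.Nat.Divisibility using (_∣_; divides)
open import Data.List using (List; []; _∷_; _∷ʳ_; length)
open import Data.List.Properties using (length-map; length-++)
open import Relation.Binary.PropositionalEquality using (_≡_; refl; sym; trans; cong; subst)
open import Function.Bundles using (mk⇔)
open import Relation.Unary using (_⊆_)

length-∷ʳ : ∀ {X : Set} (xs : List X) (x : X) → length (xs ∷ʳ x) ≡ suc (length xs)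
length-∷ʳ xs x = trans (length-++ xs) (+-comm (length xs) 1)

unsnoc : ∀ {X : Set} (u : List X) {n : ℕ} → length u ≡ suc n →
         Σ (List X) λ v → Σ X λ c → (u ≡ v ∷ʳ c) × (length v ≡ n)
unsnoc (x ∷ [])    {zero}  refl = [] , x , refl , refl
unsnoc (x ∷ y ∷ r) {suc n} eq with unsnoc (y ∷ r) (suc-injective eq)
... | v , c , e , l = x ∷ v , c , cong (x ∷_) e , cong suc l

unsnoc₂ : ∀ {X : Set} (u : List X) {n : ℕ} → length u ≡ suc (suc n) →
          Σ (List X) λ v → Σ X λ c → Σ X λ d → (u ≡ v ∷ʳ c ∷ʳ d) × (length v ≡ n)
unsnoc₂ u eq with unsnoc u eq
... | w , d , refl , l with unsnoc w l
... | v , c , refl , l' = v , c , d , refl , l'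

module PlayFacts (G : Game) where
  open Game G

  ≈-length : ∀ {s t} → s ≈ t → length s ≡ length t
  ≈-length {s} {t} s≈t =
    trans (sym (length-map pol s)) (trans (cong length (proj₁ (≈-labels s≈t))) (length-map pol t))

  ≈-split : ∀ {u s a b} → u ≈ (s ∷ʳ a ∷ʳ b) →
    Σ (List M) λ v → Σ M λ c → Σ M λ d →
      (u ≡ v ∷ʳ c ∷ʳ d) × ((v ∷ʳ c) ≈ (s ∷ʳ a)) × (v ≈ s)
  ≈-split {u} {s} {a} {b} u≈sab with unsnoc₂ u u-length
    where
      u-length : length u ≡ suc (suc (length s))
      u-length = trans (≈-length u≈sab)
                   (trans (length-∷ʳ (s ∷ʳ a) b) (cong suc (length-∷ʳ s a)))
  ... | v , c , d , refl , l = v , c , d , refl , vc≈sa , v≈s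
    where
      vc≈sa : (v ∷ʳ c) ≈ (s ∷ʳ a)
      vc≈sa = ≈-prefix {u = d ∷ []} {v = b ∷ []} u≈sab refl refl
                (trans (length-∷ʳ v c) (trans (cong suc l) (sym (length-∷ʳ s a))))
      v≈s : v ≈ s
      v≈s = ≈-prefix {u = c ∷ []} {v = a ∷ []} vc≈sa refl refl l

  plays-[] : Plays []
  plays-[] = plays-prefix [] (proj₁ plays-nonempty) (proj₂ plays-nonempty)

  even-causal-ind : (χ : PSet G) → EvenPlays G χ → CausallyConsistent G χ →
    (Motive : List M → Set) → (χ [] → Motive []) →
    (∀ {s a b} → χ (s ∷ʳ a ∷ʳ b) → Motive s → Motive (s ∷ʳ a ∷ʳ b)) →
    ∀ {s} → χ s → Motive s
  even-causal-ind χ even causal Motive base step {s} h with proj₂ (even h)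
  ... | divides k l = go k s l h
    where
      go : ∀ k s → length s ≡ k * 2 → χ s → Motive s
      go zero    [] _ h = base h
      go (suc k) s  l h with unsnoc₂ s l
      ... | v , a , b , refl , l' = step h (go k v l' (causal h))

  []∈ : (χ : PSet G) → EvenPlays G χ → CausallyConsistent G χ → ∃ χ → χ []
  []∈ χ even causal (_ , h) = even-causal-ind χ even causal (λ _ → χ []) (λ h₀ → h₀) (λ _ h₀ → h₀) h

module SkeletonFacts (G : Game) where
  open Game G
  open PlayFacts G

  -- (1) ⊑≈ implies inclusion of saturations: every play of χ is simulated,
  -- pair by pair, by an equivalent play of χ'.
  ⊑≈⇒bullet⊆ : (χ χ' : PSet G) → EvenPlays G χ → CausallyConsistent G χ →
    EvenPlays G χ' → CausallyConsistent G χ' → ∃ χ' →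
    _⊑≈_ G χ χ' → bullet G χ ⊆ bullet G χ'
  ⊑≈⇒bullet⊆ χ χ' even causal even' causal' nonempty' χ⊑χ' (s , h , s≈t) =
    let (s' , h' , s≈s') = simulate h in s' , h' , ≈-trans (≈-sym s≈s') s≈t
    where
      Simulated : List M → Set
      Simulated s = ∃ λ s' → χ' s' × s ≈ s'

      extend : ∀ {s a b} → χ (s ∷ʳ a ∷ʳ b) → Simulated s → Simulated (s ∷ʳ a ∷ʳ b)
      extend {s} {a} {b} h (s' , h' , s≈s')
        with ≈-extend s≈s' (plays-prefix (s ∷ʳ a) (b ∷ []) (proj₁ (even h)))
      ... | a' , sa≈s'a' with χ⊑χ' h h' sa≈s'a'
      ... | b' , h'' , sab≈s'a'b' = s' ∷ʳ a' ∷ʳ b' , h'' , sab≈s'a'b'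

      simulate : ∀ {s} → χ s → Simulated s
      simulate = even-causal-ind χ even causal Simulated
        (λ _ → [] , []∈ χ' even' causal' nonempty' , ≈-refl plays-[]) extend

  skeleton-⊑≈⇒bullet⊆ : (φ φ' : Skeleton G) → _⊑≈_ G (proj₁ φ) (proj₁ φ') →
    bullet G (proj₁ φ) ⊆ bullet G (proj₁ φ')
  skeleton-⊑≈⇒bullet⊆ (φ , sk) (φ' , sk') =
    ⊑≈⇒bullet⊆ φ φ' (IsSkeleton.even sk) (IsSkeleton.causal sk)
      (IsSkeleton.even sk') (IsSkeleton.causal sk') (IsSkeleton.nonempty sk')

  -- (2) Skeletons of nested strategies are ⊑≈-related: uniformization of φ'
  -- supplies the answer, determinacy of σ' makes it equivalent.
  skeletonOf-⊑≈ : (σ σ' φ φ' : PSet G) → IsStrategy G σ' → σ ⊆ σ' →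
    IsSkeletonOf G σ φ → IsSkeletonOf G σ' φ' → _⊑≈_ G φ φ'
  skeletonOf-⊑≈ σ σ' φ φ' strat' σ⊆σ' sk sk' h h' sa≈s'a' =
    let sab∈σ'            = σ⊆σ' (IsSkeletonOf.sub sk h)
        (b'' , sab≈s'a'b'') = ≈-extend sa≈s'a' (proj₁ (even sab∈σ'))
        (b' , h'' , _)     = IsSkeletonOf.uniform sk' (repInd sab∈σ' sab≈s'a'b'') h'
    in b' , h'' , determ sab∈σ' (IsSkeletonOf.sub sk' h'') sa≈s'a'
    where open IsStrategy strat'

  -- (3) Inclusion of saturations implies ⊑≈ when the larger set is a skeleton:
  -- functional representation independence of χ' transports the answer.
  bullet⊆⇒⊑≈ : (χ χ' : PSet G) → EvenPlays G χ → IsSkeleton G χ' →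
    bullet G χ ⊆ bullet G χ' → _⊑≈_ G χ χ'
  bullet⊆⇒⊑≈ χ χ' even sk' χ•⊆χ'• h h' sa≈s'a'
    with χ•⊆χ'• (_ , h , ≈-refl (proj₁ (even h)))
  ... | u , hu , u≈sab with ≈-split u≈sab
  ... | v , c , d , refl , vc≈sa , _
    with IsSkeleton.funRepInd sk' hu h' (≈-trans vc≈sa sa≈s'a')
  ... | b' , (h'' , vcd≈s'a'b') , _ = b' , h'' , ≈-trans (≈-sym u≈sab) vcd≈s'a'b'

  module Saturation (φ : PSet G) (sk : IsSkeleton G φ) where
    open IsSkeleton sk

    causal• : CausallyConsistent G (bullet G φ)
    causal• (u , h , u≈sab) with ≈-split u≈sab
    ... | v , c , d , refl , _ , v≈s = v , causal h , v≈s

    determ• : ∀ {s a b t a' b'} → bullet G φ (s ∷ʳ a ∷ʳ b) → bullet G φ (t ∷ʳ a' ∷ʳ b') →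
      (s ∷ʳ a) ≈ (t ∷ʳ a') → (s ∷ʳ a ∷ʳ b) ≈ (t ∷ʳ a' ∷ʳ b')
    determ• (u₁ , h₁ , u₁≈sab) (u₂ , h₂ , u₂≈ta'b') sa≈ta'
      with ≈-split u₁≈sab | ≈-split u₂≈ta'b'
    ... | v₁ , c₁ , d₁ , refl , q₁ , _ | v₂ , c₂ , d₂ , refl , q₂ , _
      with funRepInd h₁ (causal h₂) (≈-trans q₁ (≈-trans sa≈ta' (≈-sym q₂)))
    ... | d , (h , e) , _ with funDet h h₂
    ... | refl = ≈-sym (≈-trans (≈-sym u₂≈ta'b') (≈-trans (≈-sym e) u₁≈sab))

    strategy : IsStrategy G (bullet G φ)
    strategy = record
      { even     = λ (s , h , s≈t) →
                     proj₂ (≈-plays s≈t) , subst (2 ∣_) (≈-length s≈t) (proj₂ (even h))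
      ; nonempty = let (s , h) = nonempty in s , s , h , ≈-refl (proj₁ (even h))
      ; causal   = causal•
      ; repInd   = λ (u , h , u≈s) s≈t → u , h , ≈-trans u≈s s≈t
      ; determ   = determ•
      }

    skeletonOf : IsSkeletonOf G (bullet G φ) φ
    skeletonOf = record
      { sub      = λ h → _ , h , ≈-refl (proj₁ (even h))
      ; nonempty = nonempty
      ; causal   = causal
      ; uniform  = uniform
      }
      where
        uniform : ∀ {s a b} → bullet G φ (s ∷ʳ a ∷ʳ b) → φ s →
          Σ M λ b' → φ (s ∷ʳ a ∷ʳ b') × (∀ {y} → φ (s ∷ʳ a ∷ʳ y) → b' ≡ y)
        uniform (u , h , u≈sab) hs with ≈-split u≈sab
        ... | v , c , d , refl , vc≈sa , _ with funRepInd h hs vc≈sa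
        ... | b' , (h' , _) , _ = b' , h' , funDet h'

module Lifting (A B C : Game) (Osk : Skeleton A → Skeleton B → Skeleton C) where
  module SA = SkeletonFacts A
  module SB = SkeletonFacts B
  module SC = SkeletonFacts C

  monotone-lift : OskMonotone A B C Osk →
    ∀ (σ σ' : PSet A) (τ τ' : PSet B) → IsStrategy A σ' → IsStrategy B τ' →
    σ ⊆ σ' → τ ⊆ τ' → (φ φ' : Skeleton A) (ψ ψ' : Skeleton B) →
    IsSkeletonOf A σ (proj₁ φ) → IsSkeletonOf A σ' (proj₁ φ') →
    IsSkeletonOf B τ (proj₁ ψ) → IsSkeletonOf B τ' (proj₁ ψ') →
    bullet C (proj₁ (Osk φ ψ)) ⊆ bullet C (proj₁ (Osk φ' ψ'))
  monotone-lift mono σ σ' τ τ' strat-σ' strat-τ' σ⊆σ' τ⊆τ' φ φ' ψ ψ' skφ skφ' skψ skψ' =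
    SC.skeleton-⊑≈⇒bullet⊆ (Osk φ ψ) (Osk φ' ψ')
      (mono φ φ' ψ ψ' (SA.skeletonOf-⊑≈ σ σ' (proj₁ φ) (proj₁ φ') strat-σ' σ⊆σ' skφ skφ')
                      (SB.skeletonOf-⊑≈ τ τ' (proj₁ ψ) (proj₁ ψ') strat-τ' τ⊆τ' skψ skψ'))

  OskMonotone⇒OWellDefined : OskMonotone A B C Osk → OWellDefined A B C Osk
  OskMonotone⇒OWellDefined mono σ τ strat-σ strat-τ φ φ' ψ ψ' skφ skφ' skψ skψ' =
    monotone-lift mono σ σ τ τ strat-σ strat-τ (λ h → h) (λ h → h) φ φ' ψ ψ' skφ skφ' skψ skψ' ,
    monotone-lift mono σ σ τ τ strat-σ strat-τ (λ h → h) (λ h → h) φ' φ ψ' ψ skφ' skφ skψ' skψ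

  OskMonotone⇒OMonotone : OskMonotone A B C Osk → OMonotone A B C Osk
  OskMonotone⇒OMonotone mono σ σ' τ τ' _ strat-σ' _ strat-τ' = monotone-lift mono σ σ' τ τ' strat-σ' strat-τ'

  -- Conversely, saturating the given skeletons produces nested strategies to
  -- which monotonicity of O applies; (3) turns the resulting inclusion back into ⊑≈.
  OMonotone⇒OskMonotone : OMonotone A B C Osk → OskMonotone A B C Osk
  OMonotone⇒OskMonotone mono φ@(f , kf) φ'@(f' , kf') ψ@(g , kg) ψ'@(g' , kg') φ⊑φ' ψ⊑ψ' =
    SC.bullet⊆⇒⊑≈ (proj₁ (Osk φ ψ)) (proj₁ (Osk φ' ψ'))
      (IsSkeleton.even (proj₂ (Osk φ ψ))) (proj₂ (Osk φ' ψ'))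
      (mono (bullet A f) (bullet A f') (bullet B g) (bullet B g')
        (SA.Saturation.strategy f kf) (SA.Saturation.strategy f' kf')
        (SB.Saturation.strategy g kg) (SB.Saturation.strategy g' kg')
        (SA.skeleton-⊑≈⇒bullet⊆ φ φ' φ⊑φ') (SB.skeleton-⊑≈⇒bullet⊆ ψ ψ' ψ⊑ψ')
        φ φ' ψ ψ'
        (SA.Saturation.skeletonOf f kf) (SA.Saturation.skeletonOf f' kf')
        (SB.Saturation.skeletonOf g kg) (SB.Saturation.skeletonOf g' kg'))

mainTheorem17 : (A B C : Game) (Osk : Skeleton A → Skeleton B → Skeleton C) →
    (OWellDefined A B C Osk × OMonotone A B C Osk) ⇔ OskMonotone A B C Osk
mainTheorem17 A B C Osk =
  mk⇔ (λ (_ , mono) → OMonotone⇒OskMonotone mono)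
      (λ mono → OskMonotone⇒OWellDefined mono , OskMonotone⇒OMonotone mono)
  where open Lifting A B C Osk
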